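{- Let $k\ge 1$ and $m\ge 3$ be integers. Then $\mathrm{msum}(mk-1,k)\ge k/2$.
   Context: $S_n$ denotes the set of permutations $\pi=(\pi_1,\ldots,\pi_n)$ of $1,\ldots,n$, with indices taken cyclically: $\pi_{n+i}=\pi_i$. For $\pi\in S_n$ and $1\le k<n$ let $s_i=\sum_{j=0}^{k-1}\pi_{i+j}$ for $i=1,\ldots,n$. Define $\mathrm{msum}(\pi,k)=\max\{s_i: 1\le i\le n\}-\frac{k(n+1)}{2}$ and $\mathrm{msum}(n,k)=\min\{\mathrm{msum}(\pi,k):\pi\in S_n\}$. -}

module Defs where

open import Data.Nat using (ℕ; zero; suc; _+_; _*_; _%_; _⊔_)
open import Data.Nat.DivMod using (m%n<n)
open import Data.Fin using (Fin; toℕ; fromℕ<)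
open import Data.Fin.Permutation using (Permutation′; _⟨$⟩ʳ_)
open import Data.List using (List; map; foldr; upTo)
open import Data.Nat.ListAction using (sum)
open import Data.Integer using (+_)
open import Data.Rational using (ℚ; _/_; _-_)

-- S_n : permutations of {1,…,n}, represented as bijections Fin n ↔ Fin n
-- (value at position i is toℕ (π i) + 1).
Perm : ℕ → Set
Perm n = Permutation′ n

-- cyclic entry π_{i+1} (positions 0-indexed, indices taken mod n)
entry : {n : ℕ} → Perm n → ℕ → ℕ
entry {zero}  π i = 0
entry {suc n} π i = suc (toℕ (π ⟨$⟩ʳ fromℕ< (m%n<n i (suc n))))

-- s_{i+1} = Σ_{j=0}^{k-1} π_{i+1+j}
windowSum : {n : ℕ} → Perm n → ℕ → ℕ → ℕ
windowSum π k i = sum (map (λ j → entry π (i + j)) (upTo k))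

maxWindow : {n : ℕ} → Perm n → ℕ → ℕ
maxWindow {n} π k = foldr _⊔_ 0 (map (windowSum π k) (upTo n))

msumπ : {n : ℕ} → Perm n → ℕ → ℚ
msumπ {n} π k = (+ maxWindow π k / 1) - (+ (k * (n + 1)) / 2)

module Submission where

-- Put N = mk − 1, so a window of length k has average sum
-- k(N+1)/2 and we must show that some window sum is at least k(N+2)/2.
-- Read π cyclically and start at the position p of the largest entry N.
-- The mk = N + 1 consecutive entries π_p, …, π_{p+N} run once through the
-- whole permutation and then meet N again, so they sum to N(N+1)/2 + N.
-- They split into m windows of length k, each at most M = max window sum:
--     2·m·M  ≥  N(N+1) + 2N  =  (N+1)(N+2) − 2  =  m·k(N+2) − 2.
-- Since m ≥ 3 the slack 2 is smaller than m, so already 2M ≥ k(N+2),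
-- i.e. M − k(N+1)/2 ≥ k/2.

open import Defs
open import Data.Nat using (ℕ; zero; suc; _+_; _*_; _∸_; _%_; _⊔_; _≤_; _<_; z≤n; s≤s; _≤?_)
open import Data.Integer using (+_)
open import Data.Rational using (_/_) renaming (_≤_ to _≤ℚ_)
open import Data.Nat.Properties
open import Data.Nat.DivMod using (m%n<n; [m+n]%n≡m%n; m<n⇒m%n≡m; %-distribˡ-+; m%n%n≡m%n)
open import Data.Nat.ListAction using (sum)
open import Data.Nat.Tactic.RingSolver using (solve-∀)
open import Data.Fin using (Fin; toℕ; fromℕ)
open import Data.Fin.Properties using (fromℕ<-cong; fromℕ<-toℕ; toℕ-fromℕ; toℕ<n)
open import Data.Fin.Permutation using (_⟨$⟩ʳ_; _⟨$⟩ˡ_; inverseʳ)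
open import Data.List using (foldr; applyUpTo)
open import Data.List.Properties using (map-upTo)
open import Data.Integer as ℤ using (ℤ)
import Data.Integer.Properties as ℤP
import Data.Integer.Tactic.RingSolver as ℤSolver
open import Data.Rational using (_-_; -_; toℚᵘ)
open import Data.Rational.Properties using (toℚᵘ-cancel-≤; toℚᵘ-homo-+; toℚᵘ-homo‿-; toℚᵘ-fromℚᵘ)
open import Data.Rational.Unnormalised as ℚᵘ using (mkℚᵘ; *≤*)
import Data.Rational.Unnormalised.Properties as ℚᵘP
open import Function using (_∘_)
open import Relation.Nullary using (yes; no; contradiction)
open import Relation.Binary.PropositionalEquality
open import Algebra.Properties.CommutativeMonoid.Sum +-0-commutativeMonoid
  using (sum-cong-≗; sum-permute) renaming (sum to finSum)

rangeSum : ℕ → (ℕ → ℕ) → ℕ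
rangeSum n f = sum (applyUpTo f n)

rangeSum-cong : ∀ n {f g : ℕ → ℕ} → (∀ j → f j ≡ g j) → rangeSum n f ≡ rangeSum n g
rangeSum-cong zero    f≗g = refl
rangeSum-cong (suc n) f≗g = cong₂ _+_ (f≗g 0) (rangeSum-cong n (f≗g ∘ suc))

rangeSum-+ : ∀ a b (f : ℕ → ℕ) →
  rangeSum (a + b) f ≡ rangeSum a f + rangeSum b (λ j → f (a + j))
rangeSum-+ zero    b f = refl
rangeSum-+ (suc a) b f =
  trans (cong (_+_ (f 0)) (rangeSum-+ a b (f ∘ suc))) (sym (+-assoc (f 0) _ _))

rangeSum-last : ∀ n (f : ℕ → ℕ) → rangeSum (suc n) f ≡ rangeSum n f + f n
rangeSum-last zero    f = +-identityʳ (f 0)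
rangeSum-last (suc n) f =
  trans (cong (_+_ (f 0)) (rangeSum-last n (f ∘ suc))) (sym (+-assoc (f 0) _ _))

-- Comparison with the Fin-indexed sums of the library, which know about
-- invariance under permutations.
rangeSum-finSum : ∀ n (f : ℕ → ℕ) → rangeSum n f ≡ finSum {n} (f ∘ toℕ)
rangeSum-finSum zero    f = refl
rangeSum-finSum (suc n) f = cong (_+_ (f 0)) (rangeSum-finSum n (f ∘ suc))

triangular : ∀ n → 2 * rangeSum n suc ≡ n * suc n
triangular zero    = refl
triangular (suc n) = begin
  2 * rangeSum (suc n) suc       ≡⟨ cong (2 *_) (rangeSum-last n suc) ⟩
  2 * (rangeSum n suc + suc n)   ≡⟨ *-distribˡ-+ 2 (rangeSum n suc) (suc n) ⟩
  2 * rangeSum n suc + 2 * suc n ≡⟨ cong (_+ 2 * suc n) (triangular n) ⟩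
  n * suc n + 2 * suc n          ≡⟨ *-distribʳ-+ (suc n) n 2 ⟨
  (n + 2) * suc n                ≡⟨ *-comm (n + 2) (suc n) ⟩
  suc n * (n + 2)                ≡⟨ cong (suc n *_) (+-comm n 2) ⟩
  suc n * suc (suc n)            ∎
  where open ≡-Reasoning

le-maximum : ∀ (W : ℕ → ℕ) n {j} → j < n → W j ≤ foldr _⊔_ 0 (applyUpTo W n)
le-maximum W (suc n) {zero}  _         = m≤m⊔n (W 0) _
le-maximum W (suc n) {suc j} (s≤s j<n) = ≤-trans (le-maximum (W ∘ suc) n j<n) (m≤n⊔m (W 0) _)

Periodic : ℕ → (ℕ → ℕ) → Set
Periodic N f = ∀ i → f (i + N) ≡ f i

period-sum-suc : ∀ {N f} → Periodic N f → rangeSum N (f ∘ suc) ≡ rangeSum N f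
period-sum-suc {N} {f} per = +-cancelʳ-≡ (f 0) _ _ (begin
  rangeSum N (f ∘ suc) + f 0 ≡⟨ +-comm _ (f 0) ⟩
  rangeSum (suc N) f         ≡⟨ rangeSum-last N f ⟩
  rangeSum N f + f N         ≡⟨ cong (_+_ (rangeSum N f)) (per 0) ⟩
  rangeSum N f + f 0         ∎)
  where open ≡-Reasoning

period-sum : ∀ {N f} → Periodic N f → ∀ p → rangeSum N (λ j → f (p + j)) ≡ rangeSum N f
period-sum per zero    = refl
period-sum per (suc p) = trans (period-sum (per ∘ suc) p) (period-sum-suc per)

stretch-bound : ∀ {k M} (f : ℕ → ℕ) → (∀ i → rangeSum k (λ j → f (i + j)) ≤ M) →
  ∀ m p → rangeSum (m * k) (λ j → f (p + j)) ≤ m * M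
stretch-bound f window≤M zero    p = z≤n
stretch-bound {k} {M} f window≤M (suc m) p = begin
  rangeSum (k + m * k) (λ j → f (p + j))
    ≡⟨ rangeSum-+ k (m * k) (λ j → f (p + j)) ⟩
  rangeSum k (λ j → f (p + j)) + rangeSum (m * k) (λ j → f (p + (k + j)))
    ≡⟨ cong (_+_ (rangeSum k (λ j → f (p + j))))
            (rangeSum-cong (m * k) (λ j → cong f (sym (+-assoc p k j)))) ⟩
  rangeSum k (λ j → f (p + j)) + rangeSum (m * k) (λ j → f (p + k + j))
    ≤⟨ +-mono-≤ (window≤M p) (stretch-bound f window≤M m (p + k)) ⟩
  M + m * M ∎
  where open ≤-Reasoning

module _ {n : ℕ} (π : Perm (suc n)) where

  private
    N : ℕ
    N = suc n

  entry-cong : ∀ i j → i % N ≡ j % N → entry π i ≡ entry π j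
  entry-cong i j eq =
    cong (λ x → suc (toℕ (π ⟨$⟩ʳ x))) (fromℕ<-cong _ _ eq (m%n<n i N) (m%n<n j N))

  entry-periodic : Periodic N (entry π)
  entry-periodic i = entry-cong (i + N) i ([m+n]%n≡m%n i N)

  entry-toℕ : ∀ (i : Fin N) → entry π (toℕ i) ≡ suc (toℕ (π ⟨$⟩ʳ i))
  entry-toℕ i = cong (λ x → suc (toℕ (π ⟨$⟩ʳ x)))
    (trans (fromℕ<-cong _ _ (m<n⇒m%n≡m (toℕ<n i)) (m%n<n (toℕ i) N) (toℕ<n i))
           (fromℕ<-toℕ i (toℕ<n i)))

  entry-period-sum : rangeSum N (entry π) ≡ rangeSum N suc
  entry-period-sum = begin
    rangeSum N (entry π)                    ≡⟨ rangeSum-finSum N (entry π) ⟩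
    finSum {N} (entry π ∘ toℕ)              ≡⟨ sum-cong-≗ entry-toℕ ⟩
    finSum {N} (λ i → suc (toℕ (π ⟨$⟩ʳ i))) ≡⟨ sum-permute (suc ∘ toℕ) π ⟨
    finSum {N} (suc ∘ toℕ)                  ≡⟨ rangeSum-finSum N suc ⟨
    rangeSum N suc                          ∎
    where open ≡-Reasoning

  maxPosition : ℕ
  maxPosition = toℕ (π ⟨$⟩ˡ fromℕ n)

  entry-maxPosition : entry π maxPosition ≡ N
  entry-maxPosition = trans (entry-toℕ (π ⟨$⟩ˡ fromℕ n))
    (trans (cong (suc ∘ toℕ) (inverseʳ π)) (cong suc (toℕ-fromℕ n)))

  windowSum-range : ∀ k i → windowSum π k i ≡ rangeSum k (λ j → entry π (i + j))
  windowSum-range k i = cong sum (map-upTo (λ j → entry π (i + j)) k)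

  window-le-maxWindow : ∀ k i → rangeSum k (λ j → entry π (i + j)) ≤ maxWindow π k
  window-le-maxWindow k i = begin
    rangeSum k (λ j → entry π (i + j))
                                           ≡⟨ rangeSum-cong k (λ j → entry-cong (i + j) (i % N + j) (sym (reduce j))) ⟩
    rangeSum k (λ j → entry π (i % N + j)) ≡⟨ windowSum-range k (i % N) ⟨
    windowSum π k (i % N)                  ≤⟨ le-maximum (windowSum π k) N (m%n<n i N) ⟩
    foldr _⊔_ 0 (applyUpTo (windowSum π k) N)
                                           ≡⟨ cong (foldr _⊔_ 0) (map-upTo (windowSum π k) N) ⟨
    maxWindow π k                          ∎
    where
    open ≤-Reasoning
    reduce : ∀ j → (i % N + j) % N ≡ (i + j) % N
    reduce j = begin-equality
      (i % N + j) % N           ≡⟨ %-distribˡ-+ (i % N) j N ⟩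
      (i % N % N + j % N) % N   ≡⟨ cong (λ r → (r + j % N) % N) (m%n%n≡m%n i N) ⟩
      (i % N + j % N) % N       ≡⟨ %-distribˡ-+ i j N ⟨
      (i + j) % N               ∎

cancel-small-excess : ∀ {m c x r} → r < m → m * c ≤ m * x + r → c ≤ x
cancel-small-excess {m} {c} {x} {r} r<m mc≤mx+r with c ≤? x
... | yes c≤x = c≤x
... | no  c≰x = contradiction (+-cancelˡ-≤ (m * x) m r mx+m≤mx+r) (<⇒≱ r<m)
  where
  mx+m≤mx+r : m * x + m ≤ m * x + r
  mx+m≤mx+r = begin
    m * x + m ≡⟨ +-comm (m * x) m ⟩
    m + m * x ≡⟨ *-suc m x ⟨
    m * suc x ≤⟨ *-monoʳ-≤ m (≰⇒> c≰x) ⟩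
    m * c     ≤⟨ mc≤mx+r ⟩
    m * x + r ∎
    where open ≤-Reasoning

-- The counting identity behind the proof: with N + 1 = m·k and
-- 2T = N(N + 1) we have m·k(N + 2) = (N + 1)(N + 2) = 2(T + N) + 2.
stretch-count : ∀ m k N T → suc N ≡ m * k → 2 * T ≡ N * suc N →
  m * (k + k * (N + 1)) ≡ 2 * (T + N) + 2
stretch-count m k N T N+1≡mk 2T≡NN+1 = begin
  m * (k + k * (N + 1))   ≡⟨ expand m k N ⟩
  m * k * (N + 2)         ≡⟨ cong (_* (N + 2)) N+1≡mk ⟨
  suc N * (N + 2)         ≡⟨ regroup N ⟩
  N * suc N + 2 * N + 2   ≡⟨ cong (λ s → s + 2 * N + 2) 2T≡NN+1 ⟨
  2 * T + 2 * N + 2       ≡⟨ cong (_+ 2) (*-distribˡ-+ 2 T N) ⟨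
  2 * (T + N) + 2         ∎
  where
  open ≡-Reasoning
  expand : ∀ m k N → m * (k + k * (N + 1)) ≡ m * k * (N + 2)
  expand = solve-∀
  regroup : ∀ N → suc N * (N + 2) ≡ N * suc N + 2 * N + 2
  regroup = solve-∀

-- k + K ≤ 2M, cross-multiplied with the denominators of the unnormalised
-- fractions k/2 and M/1 − K/2.
cross-multiplied : ∀ k K M → k + K ≤ M * 2 →
  + k ℤ.* + 2 ℤ.≤ (+ M ℤ.* + 2 ℤ.+ ℤ.- + K ℤ.* + 1) ℤ.* + 2
cross-multiplied k K M k+K≤2M = begin
  + k ℤ.* + 2                                ≤⟨ ℤP.*-monoʳ-≤-nonNeg (+ 2) (ℤP.i≤i+j (+ k) (+ d)) ⟩
  (+ k ℤ.+ + d) ℤ.* + 2                      ≡⟨ cancel-K (+ k) (+ K) (+ d) ⟨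
  (+ k ℤ.+ + K ℤ.+ + d ℤ.+ ℤ.- + K ℤ.* + 1) ℤ.* + 2
                                             ≡⟨ cong (λ z → (z ℤ.+ ℤ.- + K ℤ.* + 1) ℤ.* + 2) 2M≡k+K+d ⟨
  (+ M ℤ.* + 2 ℤ.+ ℤ.- + K ℤ.* + 1) ℤ.* + 2 ∎
  where
  open ℤP.≤-Reasoning
  d : ℕ
  d = M * 2 ∸ (k + K)
  2M≡k+K+d : + M ℤ.* + 2 ≡ + k ℤ.+ + K ℤ.+ + d
  2M≡k+K+d = begin-equality
    + M ℤ.* + 2           ≡⟨ ℤP.pos-* M 2 ⟨
    + (M * 2)             ≡⟨ cong +_ (m+[n∸m]≡n k+K≤2M) ⟨
    + (k + K + d)         ≡⟨ ℤP.pos-+ (k + K) d ⟩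
    + (k + K) ℤ.+ + d     ≡⟨ cong (ℤ._+ + d) (ℤP.pos-+ k K) ⟩
    + k ℤ.+ + K ℤ.+ + d   ∎
  cancel-K : ∀ (a b c : ℤ) → (a ℤ.+ b ℤ.+ c ℤ.+ ℤ.- b ℤ.* + 1) ℤ.* + 2 ≡ (a ℤ.+ c) ℤ.* + 2
  cancel-K = ℤSolver.solve-∀

-- In ℚ, k/2 ≤ M − K/2 as soon as k + K ≤ 2M; this turns the theorem into
-- a statement about natural numbers.
half-le-diff : ∀ k K M → k + K ≤ M * 2 → (+ k / 2) ≤ℚ ((+ M / 1) - (+ K / 2))
half-le-diff k K M k+K≤2M = toℚᵘ-cancel-≤ (begin
  toℚᵘ (+ k / 2)                          ≃⟨ toℚᵘ-fromℚᵘ (mkℚᵘ (+ k) 1) ⟩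
  mkℚᵘ (+ k) 1                            ≤⟨ *≤* (cross-multiplied k K M k+K≤2M) ⟩
  mkℚᵘ (+ M) 0 ℚᵘ.- mkℚᵘ (+ K) 1          ≃⟨ difference ⟨
  toℚᵘ ((+ M / 1) - (+ K / 2))            ∎)
  where
  open ℚᵘP.≤-Reasoning
  difference : toℚᵘ ((+ M / 1) - (+ K / 2)) ℚᵘ.≃ mkℚᵘ (+ M) 0 ℚᵘ.- mkℚᵘ (+ K) 1
  difference = ℚᵘP.≃-trans (toℚᵘ-homo-+ (+ M / 1) (- (+ K / 2)))
    (ℚᵘP.+-cong (toℚᵘ-fromℚᵘ (mkℚᵘ (+ M) 0))
      (ℚᵘP.≃-trans (toℚᵘ-homo‿- (+ K / 2)) (ℚᵘP.-‿cong (toℚᵘ-fromℚᵘ (mkℚᵘ (+ K) 1)))))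

maxWindow-lower : ∀ {n k m} → suc (suc n) ≡ m * k → 3 ≤ m → (π : Perm (suc n)) →
  k + k * (suc n + 1) ≤ maxWindow π k * 2
maxWindow-lower {n} {k} {m} N+1≡mk m≥3 π = cancel-small-excess m≥3 (begin
  m * (k + k * (N + 1))          ≡⟨ stretch-count m k N (rangeSum N suc) N+1≡mk (triangular N) ⟩
  2 * (rangeSum N suc + N) + 2   ≡⟨ cong (λ s → 2 * s + 2) stretch-value ⟨
  2 * stretch + 2                ≤⟨ +-monoˡ-≤ 2 (*-monoʳ-≤ 2 stretch≤mM) ⟩
  2 * (m * M) + 2                ≡⟨ cong (_+ 2) (trans (*-comm 2 (m * M)) (*-assoc m M 2)) ⟩
  m * (M * 2) + 2                ∎)
  where
  open ≤-Reasoning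
  N M p : ℕ
  N = suc n
  M = maxWindow π k
  p = maxPosition π
  h : ℕ → ℕ
  h = entry π
  -- N + 1 consecutive entries starting at the largest one.
  stretch : ℕ
  stretch = rangeSum (suc N) (λ j → h (p + j))
  -- They run once through 1, …, N and then return to N.
  stretch-value : stretch ≡ rangeSum N suc + N
  stretch-value = begin-equality
    stretch                                  ≡⟨ rangeSum-last N (λ j → h (p + j)) ⟩
    rangeSum N (λ j → h (p + j)) + h (p + N) ≡⟨ cong₂ _+_ (period-sum (entry-periodic π) p)
                                                          (entry-periodic π p) ⟩
    rangeSum N h + h p                       ≡⟨ cong₂ _+_ (entry-period-sum π) (entry-maxPosition π) ⟩
    rangeSum N suc + N                       ∎
  -- They fill m windows of length k.
  stretch≤mM : stretch ≤ m * M
  stretch≤mM = subst (λ L → rangeSum L (λ j → h (p + j)) ≤ m * M) (sym N+1≡mk)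
    (stretch-bound h (window-le-maxWindow π k) m p)

-- The same bound for every N, the case N = 0 being excluded by m·k ≥ 3.
maxWindow-bound : ∀ N {k m} → N + 1 ≡ m * k → 1 ≤ k → 3 ≤ m → (π : Perm N) →
  k + k * (N + 1) ≤ maxWindow π k * 2
maxWindow-bound zero    N+1≡mk k≥1 m≥3 π
  with s≤s () ← ≤-trans (*-mono-≤ m≥3 k≥1) (≤-reflexive (sym N+1≡mk))
maxWindow-bound (suc n) N+1≡mk k≥1 m≥3 π = maxWindow-lower (trans (+-comm 1 (suc n)) N+1≡mk) m≥3 π

lemma4p1 : (k m : ℕ) → 1 ≤ k → 3 ≤ m →
    (π : Perm (m * k ∸ 1)) → (+ k / 2) ≤ℚ msumπ π k
lemma4p1 k m k≥1 m≥3 π =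
  half-le-diff k (k * (m * k ∸ 1 + 1)) (maxWindow π k)
    (maxWindow-bound (m * k ∸ 1) (m∸n+n≡m mk≥1) k≥1 m≥3 π)
  where
  mk≥1 : 1 ≤ m * k
  mk≥1 = ≤-trans (s≤s z≤n) (*-mono-≤ m≥3 k≥1)
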